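{- Let $(S,\cdot)$ be a finite semigroup, $\alpha$ a complete linear ordering and $\sigma$ an additive labelling from $\alpha$ to $S$. Let $E\subseteq S$ be $\mathcal D$-closed and let $\beta\subseteq\alpha$ be well-ordered with $\sigma(\beta)\subseteq E$. Then there exists a ramseyan split of height at most $|E|$ of $(\dot\beta,\sigma|_{\dot\beta})$, where $\dot\beta$ is $\beta$ with its least element removed.
   Context: An additive labelling from $\alpha$ to $S$ assigns to each pair $x<y$ in $\alpha$ an element $\sigma(x,y)\in S$ with $\sigma(x,y)\sigma(y,z)=\sigma(x,z)$ for $x<y<z$; $\sigma(\beta)=\{\sigma(x,y):x<y,\ x,y\in\beta\}$. Green's relations: $a\le_{\mathcal L}b$ iff $a=cb$, $a\le_{\mathcal R}b$ iff $a=bc$ for some $c\in S^1$; $\mathcal L,\mathcal R$ the associated equivalences; $a\,\mathcal D\,b$ iff $a\,\mathcal L\,c\,\mathcal R\,b$ for some $c$. A subset $E$ is $\mathcal D$-closed if it is a union of $\mathcal D$-classes. A split of height $N$ of a linear ordering $\gamma$ is a map $s\colon\gamma\to\{1,\dots,N\}$; $x,y$ with $s(x)=s(y)=k$ are $k$-neighbours if $s(z)\ge k$ for all $z\in\gamma$ between them (inclusive); $s$ is ramseyan if for every $k$ and all $x<y$, $x'<y'$ that are all $k$-neighbours of one another, $\sigma(x,y)=\sigma(x',y')=\sigma(x,y)^2$. -}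

module Defs where

open import Level using (0ℓ)
open import Data.Nat using (ℕ; _+_; suc) renaming (_≤_ to _≤ℕ_)
open import Data.Fin using (Fin)
open import Data.Fin.Subset using (Subset; _∈_; ∣_∣)
open import Data.Product using (Σ; _×_; ∃; ∃-syntax; _,_)
open import Data.Sum using (_⊎_)
open import Relation.Nullary using (Dec; ¬_)
open import Relation.Binary.PropositionalEquality using (_≡_)
open import Relation.Binary.Definitions using (Trichotomous)
open import Relation.Binary.Structures using (IsStrictTotalOrder)

ExcludedMiddle : Set₁
ExcludedMiddle = (P : Set) → Dec P

-- Finite semigroups: carrier Fin n (every finite semigroup is
-- isomorphic to one of this form) with an associative operation.

record FiniteSemigroup : Set where
  field
    size  : ℕ
    _·_   : Fin size → Fin size → Fin size
    assoc : ∀ a b c → (a · b) · c ≡ a · (b · c)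

module Green (S : FiniteSemigroup) where
  open FiniteSemigroup S

  -- a ≤L b iff a = c b for some c ∈ S¹
  _≤L_ : Fin size → Fin size → Set
  a ≤L b = (a ≡ b) ⊎ (∃[ c ] a ≡ c · b)

  -- a ≤R b iff a = b c for some c ∈ S¹
  _≤R_ : Fin size → Fin size → Set
  a ≤R b = (a ≡ b) ⊎ (∃[ c ] a ≡ b · c)

  _L_ : Fin size → Fin size → Set
  a L b = (a ≤L b) × (b ≤L a)

  _R_ : Fin size → Fin size → Set
  a R b = (a ≤R b) × (b ≤R a)

  _D_ : Fin size → Fin size → Set
  a D b = ∃[ c ] (a L c × c R b)

  DClosed : Subset size → Set
  DClosed E = ∀ a b → a D b → a ∈ E → b ∈ E

record LinearOrdering : Set₁ where
  field
    Carrier : Set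
    _<_     : Carrier → Carrier → Set
    isSTO   : IsStrictTotalOrder _≡_ _<_

module LO (α : LinearOrdering) where
  open LinearOrdering α public

  _≼_ : Carrier → Carrier → Set
  x ≼ y = (x < y) ⊎ (x ≡ y)

  Pred : Set₁
  Pred = Carrier → Set

  IsUpperBound : Pred → Carrier → Set
  IsUpperBound P u = ∀ x → P x → x ≼ u

  IsSup : Pred → Carrier → Set
  IsSup P u = IsUpperBound P u × (∀ v → IsUpperBound P v → u ≼ v)

  Complete : Set₁
  Complete = (P : Pred) → ∃[ u ] IsSup P u

  IsLeast : Pred → Carrier → Set
  IsLeast P m = P m × (∀ x → P x → m ≼ x)

  WellOrdered : Pred → Set₁
  WellOrdered β = (P : Pred) → (∀ x → P x → β x) → (∃[ x ] P x) → ∃[ m ] IsLeast P m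

  -- β with its least element removed (= elements of β that are not least)
  dot : Pred → Pred
  dot β x = β x × (∃[ y ] (β y × y < x))

-- Additive labellings σ from α to S. σ is given on all pairs, but only
-- its values on pairs x < y are meaningful.

module Labelling (α : LinearOrdering) (S : FiniteSemigroup) where
  open LO α
  open FiniteSemigroup S

  IsAdditive : (Carrier → Carrier → Fin size) → Set
  IsAdditive σ = ∀ x y z → x < y → y < z → σ x y · σ y z ≡ σ x z

  ImageIn : (Carrier → Carrier → Fin size) → Pred → Subset size → Set
  ImageIn σ β E = ∀ x y → β x → β y → x < y → σ x y ∈ E

  IsSplit : Pred → ℕ → (Carrier → ℕ) → Set
  IsSplit γ N s = ∀ x → γ x → (1 ≤ℕ s x) × (s x ≤ℕ N)

  Neighbours : Pred → (Carrier → ℕ) → ℕ → Carrier → Carrier → Set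
  Neighbours γ s k x y =
    γ x × γ y × (s x ≡ k) × (s y ≡ k) ×
    (∀ z → γ z → ((x ≼ z × z ≼ y) ⊎ (y ≼ z × z ≼ x)) → k ≤ℕ s z)

  Ramseyan : (Carrier → Carrier → Fin size) → Pred → (Carrier → ℕ) → Set
  Ramseyan σ γ s = ∀ k x y x′ y′ → x < y → x′ < y′ →
    Neighbours γ s k x y → Neighbours γ s k x x′ → Neighbours γ s k x y′ →
    Neighbours γ s k y x′ → Neighbours γ s k y y′ → Neighbours γ s k x′ y′ →
    (σ x y ≡ σ x′ y′) × (σ x y ≡ σ x y · σ x y)

module Submission where

-- Induction on |E|.  The 𝒟-class D₀ of a ≤𝒥-minimal element of E absorbs every product that stays in
-- E.  Cut β at the points x with σ(c, x) ∈ D₀ for all earlier cuts c.  Inside a segment between two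
-- consecutive cuts no label lies in D₀, so by induction each segment has a ramseyan split of height
-- |E ∖ D₀|, which is shifted above the levels 1, …, |D₀| reserved for the cuts.  A cut x is placed at
-- the rank of its code, an element of D₀ which, by Green's lemma, determines both σ(b₀, x) and the
-- 𝓡-class of the labels σ(x, y) to later cuts y; equal codes then force σ(x, y) to be the idempotent
-- of a single ℋ-class.

open import Defs
open import Level using (0ℓ)
open import Data.Bool using (Bool; true; false)
open import Data.Bool.Properties using (¬-not) renaming (_≟_ to _≟ᵇ_)
open import Data.Empty using (⊥; ⊥-elim)
open import Data.Fin using (Fin; toℕ) renaming (zero to fzero; suc to fsuc)
open import Data.Fin.Properties using (pigeonhole)
open import Data.Fin.Subset using (Subset; _∈_; _∉_; _∩_; _─_; ∣_∣; inside; outside)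
open import Data.Fin.Subset.Properties using (p⊂q⇒∣p∣<∣q∣; p⊆q⇒∣p∣≤∣q∣; x∈p∩q⁺; x∈p∧x∉q⇒x∈p─q; p─q⊆p)
open import Data.Maybe using (Maybe; just; nothing)
open import Data.Maybe.Properties using (just-injective)
open import Data.Nat using (ℕ; zero; suc; _+_; _*_; _∸_; z≤n; s≤s) renaming (_≤_ to _≤ℕ_; _<_ to _<ℕ_)
open import Data.Nat.Properties
  using (+-assoc; +-comm; +-suc; m<m+n; suc-injective; +-identityʳ; m≤m*n; m≤n+m; m≤m+n; ≤-trans; ≤-refl; ≤-reflexive;
         n<1+n; <-≤-trans; m≤n⇒∃[o]m+o≡n; +-monoˡ-≤; +-monoʳ-≤; <⇒≱; m+n∸m≡n; ∸-monoˡ-≤)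
open import Data.Product using (_,_; _×_; proj₁; proj₂; ∃; ∃-syntax)
open import Data.Sum using (inj₁; inj₂)
open import Data.Vec using ([]; _∷_; tabulate)
open import Data.Vec.Base using (here; there)
open import Data.Vec.Properties using ([]=⇒lookup; lookup⇒[]=; lookup∘tabulate; tabulate-cong)
open import Function using (_⇔_; mk⇔; case_of_)
open import Relation.Nullary using (Dec; yes; no; ¬_; does)
open import Relation.Nullary.Decidable using (decidable-stable; dec-true; dec-false; does-⇔)
open import Relation.Binary.Definitions using (tri<; tri≈; tri>)
open import Relation.Binary.Structures using (IsStrictTotalOrder)
open import Induction.WellFounded using (Acc; acc; WellFounded; WfRec; module All; module FixPoint)
open import Relation.Binary.PropositionalEquality

module Green¹ (S : FiniteSemigroup) where
  open FiniteSemigroup S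
  open ≡-Reasoning

  A : Set
  A = Fin size

  S¹ : Set
  S¹ = Maybe A

  infixl 7 _∙_
  _∙_ : S¹ → S¹ → S¹
  nothing ∙ y      = y
  just a  ∙ nothing = just a
  just a  ∙ just b  = just (a · b)

  ∙-assoc : ∀ x y z → x ∙ y ∙ z ≡ x ∙ (y ∙ z)
  ∙-assoc nothing  y        z        = refl
  ∙-assoc (just a) nothing  z        = refl
  ∙-assoc (just a) (just b) nothing  = refl
  ∙-assoc (just a) (just b) (just c) = cong just (assoc a b c)

  ∙-identityʳ : ∀ x → x ∙ nothing ≡ x
  ∙-identityʳ nothing  = refl
  ∙-identityʳ (just a) = refl

  infixr 8 _^_
  _^_ : S¹ → ℕ → S¹
  x ^ zero  = nothing
  x ^ suc n = x ∙ x ^ n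

  ^-+ : ∀ x m n → x ^ (m + n) ≡ x ^ m ∙ x ^ n
  ^-+ x zero    n = refl
  ^-+ x (suc m) n = trans (cong (x ∙_) (^-+ x m n)) (sym (∙-assoc x (x ^ m) (x ^ n)))

  ^-sucʳ : ∀ x n → x ^ suc n ≡ x ^ n ∙ x
  ^-sucʳ x n = begin
    x ^ suc n      ≡⟨ cong (x ^_) (+-comm 1 n) ⟩
    x ^ (n + 1)    ≡⟨ ^-+ x n 1 ⟩
    x ^ n ∙ x ^ 1  ≡⟨ cong (x ^ n ∙_) (∙-identityʳ x) ⟩
    x ^ n ∙ x      ∎

  toFin : S¹ → Fin (suc size)
  toFin nothing  = fzero
  toFin (just a) = fsuc a

  toFin-injective : ∀ x y → toFin x ≡ toFin y → x ≡ y
  toFin-injective nothing  nothing  _    = refl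
  toFin-injective (just a) (just b) refl = refl

  module _ (x : S¹) {i p : ℕ} (period : x ^ i ≡ x ^ (i + p)) where

    ^-shift : ∀ m → i ≤ℕ m → x ^ (m + p) ≡ x ^ m
    ^-shift m i≤m with t , refl ← m≤n⇒∃[o]m+o≡n i≤m = begin
      x ^ (i + t + p)    ≡⟨ cong (x ^_) (trans (+-assoc i t p) (trans (cong (i +_) (+-comm t p)) (sym (+-assoc i p t)))) ⟩
      x ^ (i + p + t)    ≡⟨ ^-+ x (i + p) t ⟩
      x ^ (i + p) ∙ x ^ t ≡⟨ cong (_∙ x ^ t) period ⟨
      x ^ i ∙ x ^ t      ≡⟨ ^-+ x i t ⟨
      x ^ (i + t)        ∎

    ^-periodic : ∀ m q → i ≤ℕ m → x ^ (m + q * p) ≡ x ^ m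
    ^-periodic m zero    _   = cong (x ^_) (+-identityʳ m)
    ^-periodic m (suc q) i≤m = begin
      x ^ (m + (p + q * p)) ≡⟨ cong (x ^_) (trans (cong (m +_) (+-comm p (q * p))) (sym (+-assoc m (q * p) p))) ⟩
      x ^ (m + q * p + p)   ≡⟨ ^-shift (m + q * p) (≤-trans i≤m (m≤m+n m (q * p))) ⟩
      x ^ (m + q * p)       ≡⟨ ^-periodic m q i≤m ⟩
      x ^ m                 ∎

  -- The powers x⁰, …, x^(size+1) take at most size + 1 values, so x^i = x^(i+p) for some p > 0;
  -- then x^n is idempotent for n = (i+1)p.  (Abstract: unfolding the pigeonhole witness makes
  -- checking the lemmas that use it very slow.)
  abstract
    ∃-idempotent-power : ∀ x → ∃[ n ] x ^ suc n ∙ x ^ suc n ≡ x ^ suc n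
    ∃-idempotent-power x
      with i , j , i<j , x^i≡x^j ← pigeonhole (n<1+n (suc size)) (λ k → toFin (x ^ toℕ k))
      with d , i+1+d≡j ← m≤n⇒∃[o]m+o≡n i<j = d + toℕ i * suc d , (begin
        x ^ n ∙ x ^ n             ≡⟨ ^-+ x n n ⟨
        x ^ (n + suc i′ * suc d)  ≡⟨ ^-periodic x period n (suc i′) i≤n ⟩
        x ^ n                     ∎)
      where
      i′ n : ℕ
      i′ = toℕ i
      n  = suc i′ * suc d
      period : x ^ i′ ≡ x ^ (i′ + suc d)
      period = trans (toFin-injective _ _ x^i≡x^j) (cong (x ^_) (trans (sym i+1+d≡j) (sym (+-suc i′ d))))
      i≤n : i′ ≤ℕ n
      i≤n = ≤-trans (m≤m*n i′ (suc d)) (m≤n+m (i′ * suc d) (suc d))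

  infixr 6 _◃_
  _◃_ : S¹ → A → A
  nothing ◃ a = a
  just u  ◃ a = u · a

  infixl 6 _▹_
  _▹_ : A → S¹ → A
  a ▹ nothing = a
  a ▹ just u  = a · u

  ◃-∙ : ∀ u a → just (u ◃ a) ≡ u ∙ just a
  ◃-∙ nothing  a = refl
  ◃-∙ (just u) a = refl

  ▹-∙ : ∀ a u → just (a ▹ u) ≡ just a ∙ u
  ▹-∙ a nothing  = refl
  ▹-∙ a (just u) = refl

  infix 4 _≤L_ _≤R_ _≤J_ _L_ _R_ _D_

  _≤L_ : A → A → Set
  a ≤L b = ∃[ t ] just a ≡ t ∙ just b

  _≤R_ : A → A → Set
  a ≤R b = ∃[ t ] just a ≡ just b ∙ t

  _≤J_ : A → A → Set
  a ≤J b = ∃[ u ] ∃[ v ] just a ≡ u ∙ just b ∙ v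

  _L_ : A → A → Set
  a L b = a ≤L b × b ≤L a

  _R_ : A → A → Set
  a R b = a ≤R b × b ≤R a

  _D_ : A → A → Set
  a D b = ∃[ c ] a L c × c R b

  ≤L-refl : ∀ {a} → a ≤L a
  ≤L-refl = nothing , refl

  ≤R-refl : ∀ {a} → a ≤R a
  ≤R-refl = nothing , refl

  ≤J-refl : ∀ {a} → a ≤J a
  ≤J-refl = nothing , nothing , refl

  ≤L-trans : ∀ {a b c} → a ≤L b → b ≤L c → a ≤L c
  ≤L-trans {c = c} (t , a≡tb) (t′ , b≡t′c) =
    t ∙ t′ , trans a≡tb (trans (cong (t ∙_) b≡t′c) (sym (∙-assoc t t′ (just c))))

  ≤R-trans : ∀ {a b c} → a ≤R b → b ≤R c → a ≤R c
  ≤R-trans {c = c} (t , a≡bt) (t′ , b≡ct′) =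
    t′ ∙ t , trans a≡bt (trans (cong (_∙ t) b≡ct′) (∙-assoc (just c) t′ t))

  ≤J-trans : ∀ {a b c} → a ≤J b → b ≤J c → a ≤J c
  ≤J-trans {a} {b} {c} (u , v , a≡ubv) (u′ , v′ , b≡u′cv′) = u ∙ u′ , v′ ∙ v , (begin
    just a                           ≡⟨ a≡ubv ⟩
    u ∙ just b ∙ v                   ≡⟨ cong (λ y → u ∙ y ∙ v) b≡u′cv′ ⟩
    u ∙ (u′ ∙ just c ∙ v′) ∙ v       ≡⟨ cong (_∙ v) (∙-assoc u (u′ ∙ just c) v′) ⟨
    u ∙ (u′ ∙ just c) ∙ v′ ∙ v       ≡⟨ ∙-assoc (u ∙ (u′ ∙ just c)) v′ v ⟩
    u ∙ (u′ ∙ just c) ∙ (v′ ∙ v)     ≡⟨ cong (_∙ (v′ ∙ v)) (∙-assoc u u′ (just c)) ⟨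
    u ∙ u′ ∙ just c ∙ (v′ ∙ v)       ∎)

  L-refl : ∀ {a} → a L a
  L-refl = ≤L-refl , ≤L-refl

  R-refl : ∀ {a} → a R a
  R-refl = ≤R-refl , ≤R-refl

  L-sym : ∀ {a b} → a L b → b L a
  L-sym (p , q) = q , p

  R-sym : ∀ {a b} → a R b → b R a
  R-sym (p , q) = q , p

  L-trans : ∀ {a b c} → a L b → b L c → a L c
  L-trans (p , p′) (q , q′) = ≤L-trans p q , ≤L-trans q′ p′

  R-trans : ∀ {a b c} → a R b → b R c → a R c
  R-trans (p , p′) (q , q′) = ≤R-trans p q , ≤R-trans q′ p′

  R∘L⇒L∘R : ∀ {a y z} → a R y → y L z → ∃[ w ] a L w × w R z
  R∘L⇒L∘R {a} {y} {z} ((s′ , a≡ys′) , (s , y≡as)) ((t , y≡tz) , (t′ , z≡t′y)) =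
    t′ ◃ a , (a≤w , (t′ , w≡t′a)) , (w≤z , z≤w)
    where
    w≡t′a : just (t′ ◃ a) ≡ t′ ∙ just a
    w≡t′a = ◃-∙ t′ a
    a≤w : a ≤L t′ ◃ a
    a≤w = t , (begin
      just a                  ≡⟨ a≡ys′ ⟩
      just y ∙ s′             ≡⟨ cong (_∙ s′) y≡tz ⟩
      t ∙ just z ∙ s′         ≡⟨ ∙-assoc t (just z) s′ ⟩
      t ∙ (just z ∙ s′)       ≡⟨ cong (λ q → t ∙ (q ∙ s′)) z≡t′y ⟩
      t ∙ (t′ ∙ just y ∙ s′)  ≡⟨ cong (t ∙_) (∙-assoc t′ (just y) s′) ⟩
      t ∙ (t′ ∙ (just y ∙ s′)) ≡⟨ cong (λ q → t ∙ (t′ ∙ q)) a≡ys′ ⟨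
      t ∙ (t′ ∙ just a)       ≡⟨ cong (t ∙_) w≡t′a ⟨
      t ∙ just (t′ ◃ a)       ∎)
    w≤z : t′ ◃ a ≤R z
    w≤z = s′ , (begin
      just (t′ ◃ a)           ≡⟨ w≡t′a ⟩
      t′ ∙ just a             ≡⟨ cong (t′ ∙_) a≡ys′ ⟩
      t′ ∙ (just y ∙ s′)      ≡⟨ ∙-assoc t′ (just y) s′ ⟨
      t′ ∙ just y ∙ s′        ≡⟨ cong (_∙ s′) z≡t′y ⟨
      just z ∙ s′             ∎)
    z≤w : z ≤R t′ ◃ a
    z≤w = s , (begin
      just z                  ≡⟨ z≡t′y ⟩
      t′ ∙ just y             ≡⟨ cong (t′ ∙_) y≡as ⟩
      t′ ∙ (just a ∙ s)       ≡⟨ ∙-assoc t′ (just a) s ⟨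
      t′ ∙ just a ∙ s         ≡⟨ cong (_∙ s) w≡t′a ⟨
      just (t′ ◃ a) ∙ s       ∎)

  R∘L⇒D : ∀ {a y z} → a R y → y L z → a D z
  R∘L⇒D aRy yLz = R∘L⇒L∘R aRy yLz

  D-refl : ∀ {a} → a D a
  D-refl = _ , L-refl , R-refl

  D-sym : ∀ {a b} → a D b → b D a
  D-sym (c , aLc , cRb) = R∘L⇒D (R-sym cRb) (L-sym aLc)

  D-trans : ∀ {a b c} → a D b → b D c → a D c
  D-trans (x , aLx , xRb) (y , bLy , yRc) with w , xLw , wRy ← R∘L⇒L∘R xRb bLy =
    w , L-trans aLx xLw , R-trans wRy yRc

  R⇒D : ∀ {a b} → a R b → a D b
  R⇒D aRb = _ , L-refl , aRb

  D⇒≤J : ∀ {a b} → a D b → a ≤J b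
  D⇒≤J {a} {b} (c , ((t , a≡tc) , _) , ((s , c≡bs) , _)) =
    t , s , trans a≡tc (trans (cong (t ∙_) c≡bs) (sym (∙-assoc t (just b) s)))

  module _ {a u x : S¹} (a≡uax : a ≡ u ∙ a ∙ x) where

    loop-^ : ∀ n → a ≡ u ^ n ∙ a ∙ x ^ n
    loop-^ zero    = sym (∙-identityʳ a)
    loop-^ (suc n) = begin
      a                               ≡⟨ loop-^ n ⟩
      u ^ n ∙ a ∙ x ^ n               ≡⟨ cong (λ y → u ^ n ∙ y ∙ x ^ n) a≡uax ⟩
      u ^ n ∙ (u ∙ a ∙ x) ∙ x ^ n     ≡⟨ ∙-assoc (u ^ n) (u ∙ a ∙ x) (x ^ n) ⟩
      u ^ n ∙ (u ∙ a ∙ x ∙ x ^ n)     ≡⟨ cong (u ^ n ∙_) (∙-assoc (u ∙ a) x (x ^ n)) ⟩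
      u ^ n ∙ (u ∙ a ∙ x ^ suc n)     ≡⟨ ∙-assoc (u ^ n) (u ∙ a) (x ^ suc n) ⟨
      u ^ n ∙ (u ∙ a) ∙ x ^ suc n     ≡⟨ cong (_∙ x ^ suc n) (∙-assoc (u ^ n) u a) ⟨
      u ^ n ∙ u ∙ a ∙ x ^ suc n       ≡⟨ cong (λ y → y ∙ a ∙ x ^ suc n) (^-sucʳ u n) ⟨
      u ^ suc n ∙ a ∙ x ^ suc n       ∎

    -- Iterate a = u a x up to an idempotent power e of x (resp. of u): then a = a e (resp. a = e a).
    loop⇒≤R : ∃[ t ] a ≡ a ∙ x ∙ t
    loop⇒≤R = x ^ k , (begin
      a                           ≡⟨ a≡a∙e ⟩
      a ∙ x ^ suc k               ≡⟨ ∙-assoc a x (x ^ k) ⟨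
      a ∙ x ∙ x ^ k               ∎)
      where
      k = proj₁ (∃-idempotent-power x)
      e = x ^ suc k
      e∙e≡e : e ∙ e ≡ e
      e∙e≡e = proj₂ (∃-idempotent-power x)
      a≡a∙e : a ≡ a ∙ e
      a≡a∙e = begin
        a                         ≡⟨ loop-^ (suc k) ⟩
        u ^ suc k ∙ a ∙ e         ≡⟨ cong (u ^ suc k ∙ a ∙_) e∙e≡e ⟨
        u ^ suc k ∙ a ∙ (e ∙ e)   ≡⟨ ∙-assoc (u ^ suc k ∙ a) e e ⟨
        u ^ suc k ∙ a ∙ e ∙ e     ≡⟨ cong (_∙ e) (loop-^ (suc k)) ⟨
        a ∙ e                     ∎

    loop⇒≤L : ∃[ t ] a ≡ t ∙ (u ∙ a)
    loop⇒≤L = u ^ k , (begin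
      a                           ≡⟨ a≡e∙a ⟩
      e ∙ a                       ≡⟨ cong (_∙ a) (^-sucʳ u k) ⟩
      u ^ k ∙ u ∙ a               ≡⟨ ∙-assoc (u ^ k) u a ⟩
      u ^ k ∙ (u ∙ a)             ∎)
      where
      k = proj₁ (∃-idempotent-power u)
      e = u ^ suc k
      e∙e≡e : e ∙ e ≡ e
      e∙e≡e = proj₂ (∃-idempotent-power u)
      x′ = x ^ suc k
      a≡e∙a : a ≡ e ∙ a
      a≡e∙a = begin
        a                         ≡⟨ loop-^ (suc k) ⟩
        e ∙ a ∙ x′                ≡⟨ cong (λ y → y ∙ a ∙ x′) e∙e≡e ⟨
        e ∙ e ∙ a ∙ x′            ≡⟨ cong (_∙ x′) (∙-assoc e e a) ⟩
        e ∙ (e ∙ a) ∙ x′          ≡⟨ ∙-assoc e (e ∙ a) x′ ⟩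
        e ∙ (e ∙ a ∙ x′)          ≡⟨ cong (e ∙_) (loop-^ (suc k)) ⟨
        e ∙ a                     ∎

  -- In a finite semigroup 𝒥 = 𝒟: with a = u b v and b = u′ a v′, a R a v′ L b.
  ≤J-antisym⇒D : ∀ {a b} → a ≤J b → b ≤J a → a D b
  ≤J-antisym⇒D {a} {b} (u , v , a≡ubv) (u′ , v′ , b≡u′av′) = R∘L⇒D a-R-z z-L-b
    where
    a≡loop : just a ≡ u ∙ u′ ∙ just a ∙ (v′ ∙ v)
    a≡loop = begin
      just a                              ≡⟨ a≡ubv ⟩
      u ∙ just b ∙ v                      ≡⟨ cong (λ y → u ∙ y ∙ v) b≡u′av′ ⟩
      u ∙ (u′ ∙ just a ∙ v′) ∙ v          ≡⟨ cong (_∙ v) (∙-assoc u (u′ ∙ just a) v′) ⟨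
      u ∙ (u′ ∙ just a) ∙ v′ ∙ v          ≡⟨ ∙-assoc (u ∙ (u′ ∙ just a)) v′ v ⟩
      u ∙ (u′ ∙ just a) ∙ (v′ ∙ v)        ≡⟨ cong (_∙ (v′ ∙ v)) (∙-assoc u u′ (just a)) ⟨
      u ∙ u′ ∙ just a ∙ (v′ ∙ v)          ∎
    z = a ▹ v′
    z≡av′ : just z ≡ just a ∙ v′
    z≡av′ = ▹-∙ a v′
    a-R-z : a R z
    a-R-z with t , a≡a∙v′v∙t ← loop⇒≤R {u = u ∙ u′} {x = v′ ∙ v} a≡loop =
      (v ∙ t , (begin
        just a                  ≡⟨ a≡a∙v′v∙t ⟩
        just a ∙ (v′ ∙ v) ∙ t   ≡⟨ cong (_∙ t) (∙-assoc (just a) v′ v) ⟨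
        just a ∙ v′ ∙ v ∙ t     ≡⟨ ∙-assoc (just a ∙ v′) v t ⟩
        just a ∙ v′ ∙ (v ∙ t)   ≡⟨ cong (_∙ (v ∙ t)) z≡av′ ⟨
        just z ∙ (v ∙ t)        ∎)) , (v′ , z≡av′)
    z-L-b : z L b
    z-L-b with t , a≡t∙uu′a ← loop⇒≤L {u = u ∙ u′} {x = v′ ∙ v} a≡loop =
      (t ∙ u , (begin
        just z                         ≡⟨ z≡av′ ⟩
        just a ∙ v′                    ≡⟨ cong (_∙ v′) a≡t∙uu′a ⟩
        t ∙ (u ∙ u′ ∙ just a) ∙ v′     ≡⟨ cong (λ y → t ∙ y ∙ v′) (∙-assoc u u′ (just a)) ⟩
        t ∙ (u ∙ (u′ ∙ just a)) ∙ v′   ≡⟨ cong (_∙ v′) (∙-assoc t u (u′ ∙ just a)) ⟨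
        t ∙ u ∙ (u′ ∙ just a) ∙ v′     ≡⟨ ∙-assoc (t ∙ u) (u′ ∙ just a) v′ ⟩
        t ∙ u ∙ (u′ ∙ just a ∙ v′)     ≡⟨ cong (t ∙ u ∙_) b≡u′av′ ⟨
        t ∙ u ∙ just b                 ∎)) ,
      (u′ , trans b≡u′av′ (trans (∙-assoc u′ (just a) v′) (cong (u′ ∙_) (sym z≡av′))))

  D-stableʳ : ∀ a b → a D a · b → a R a · b
  D-stableʳ a b a-D-ab with u , v , a≡u∙ab∙v ← D⇒≤J a-D-ab
    with t , a≡a∙bv∙t ← loop⇒≤R {u = u} {x = just b ∙ v} (trans a≡u∙ab∙v (trans (cong (_∙ v) (sym (∙-assoc u (just a) (just b)))) (∙-assoc (u ∙ just a) (just b) v))) =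
    (v ∙ t , trans a≡a∙bv∙t (trans (cong (_∙ t) (sym (∙-assoc (just a) (just b) v))) (∙-assoc (just (a · b)) v t))) ,
    (just b , refl)

  D-stableˡ : ∀ a b → b D a · b → b L a · b
  D-stableˡ a b b-D-ab with u , v , b≡u∙ab∙v ← D⇒≤J b-D-ab
    with t , b≡t∙ua∙b ← loop⇒≤L {u = u ∙ just a} {x = v} (trans b≡u∙ab∙v (cong (_∙ v) (sym (∙-assoc u (just a) (just b))))) =
    (t ∙ u , trans b≡t∙ua∙b (trans (cong (t ∙_) (∙-assoc u (just a) (just b))) (sym (∙-assoc t u (just (a · b)))))) ,
    (just a , refl)

  ◃-cong-≤R : ∀ u {a b} → a ≤R b → u ◃ a ≤R u ◃ b
  ◃-cong-≤R u {a} {b} (t , a≡bt) = t , (begin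
    just (u ◃ a)       ≡⟨ ◃-∙ u a ⟩
    u ∙ just a         ≡⟨ cong (u ∙_) a≡bt ⟩
    u ∙ (just b ∙ t)   ≡⟨ ∙-assoc u (just b) t ⟨
    u ∙ just b ∙ t     ≡⟨ cong (_∙ t) (◃-∙ u b) ⟨
    just (u ◃ b) ∙ t   ∎)

  ◃-cong-R : ∀ u {a b} → a R b → u ◃ a R u ◃ b
  ◃-cong-R u (a≤b , b≤a) = ◃-cong-≤R u a≤b , ◃-cong-≤R u b≤a

  ◃-inverse-≤R : ∀ {u v a b} → just a ≡ v ∙ just (u ◃ a) → b ≤R a → just b ≡ v ∙ just (u ◃ b)
  ◃-inverse-≤R {u} {v} {a} {b} a≡vua (t , b≡at) = begin
    just b                ≡⟨ b≡at ⟩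
    just a ∙ t            ≡⟨ cong (_∙ t) a≡vua ⟩
    v ∙ just (u ◃ a) ∙ t  ≡⟨ cong (λ y → v ∙ y ∙ t) (◃-∙ u a) ⟩
    v ∙ (u ∙ just a) ∙ t  ≡⟨ ∙-assoc v (u ∙ just a) t ⟩
    v ∙ (u ∙ just a ∙ t)  ≡⟨ cong (v ∙_) (∙-assoc u (just a) t) ⟩
    v ∙ (u ∙ (just a ∙ t)) ≡⟨ cong (λ y → v ∙ (u ∙ y)) b≡at ⟨
    v ∙ (u ∙ just b)      ≡⟨ cong (v ∙_) (◃-∙ u b) ⟨
    v ∙ just (u ◃ b)      ∎

  IsIdempotent : A → Set
  IsIdempotent g = g · g ≡ g

  idempotent-absorbed : ∀ {a g} → a · g ≡ a → g ≤L a → IsIdempotent g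
  idempotent-absorbed {a} {g} a·g≡a (t , g≡ta) = just-injective (begin
    just g ∙ just g      ≡⟨ cong (_∙ just g) g≡ta ⟩
    t ∙ just a ∙ just g  ≡⟨ ∙-assoc t (just a) (just g) ⟩
    t ∙ just (a · g)     ≡⟨ cong (λ q → t ∙ just q) a·g≡a ⟩
    t ∙ just a           ≡⟨ g≡ta ⟨
    just g               ∎)

  -- With g = s g′ and g′ = g t′: g = s g′ g′ = g g′ = g g t′ = g′.
  idempotent-ℋ-unique : ∀ {g g′} → IsIdempotent g → IsIdempotent g′ → g R g′ → g L g′ → g ≡ g′
  idempotent-ℋ-unique {g} {g′} gg≡g g′g′≡g′ (_ , (t′ , g′≡gt′)) ((s , g≡sg′) , _) = just-injective (begin
    just g                  ≡⟨ g≡sg′ ⟩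
    s ∙ just g′             ≡⟨ cong (λ q → s ∙ just q) g′g′≡g′ ⟨
    s ∙ just (g′ · g′)      ≡⟨ ∙-assoc s (just g′) (just g′) ⟨
    s ∙ just g′ ∙ just g′   ≡⟨ cong (_∙ just g′) g≡sg′ ⟨
    just g ∙ just g′        ≡⟨ cong (just g ∙_) g′≡gt′ ⟩
    just g ∙ (just g ∙ t′)  ≡⟨ ∙-assoc (just g) (just g) t′ ⟨
    just (g · g) ∙ t′       ≡⟨ cong (λ q → just q ∙ t′) gg≡g ⟩
    just g ∙ t′             ≡⟨ g′≡gt′ ⟨
    just g′                 ∎)

  module G = Green S

  ≤L-of-Green : ∀ {a b} → a G.≤L b → a ≤L b
  ≤L-of-Green (inj₁ refl)      = ≤L-refl
  ≤L-of-Green (inj₂ (c , a≡cb)) = just c , cong just a≡cb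

  ≤R-of-Green : ∀ {a b} → a G.≤R b → a ≤R b
  ≤R-of-Green (inj₁ refl)      = ≤R-refl
  ≤R-of-Green (inj₂ (c , a≡bc)) = just c , cong just a≡bc

  ≤L-to-Green : ∀ {a b} → a ≤L b → a G.≤L b
  ≤L-to-Green (nothing , a≡b)  = inj₁ (just-injective a≡b)
  ≤L-to-Green (just c , a≡cb)  = inj₂ (c , just-injective a≡cb)

  ≤R-to-Green : ∀ {a b} → a ≤R b → a G.≤R b
  ≤R-to-Green (nothing , a≡b)  = inj₁ (just-injective a≡b)
  ≤R-to-Green (just c , a≡bc)  = inj₂ (c , just-injective a≡bc)

  D-of-Green : ∀ {a b} → a G.D b → a D b
  D-of-Green (c , (p , q) , (r , s)) = c , (≤L-of-Green p , ≤L-of-Green q) , (≤R-of-Green r , ≤R-of-Green s)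

  D-to-Green : ∀ {a b} → a D b → a G.D b
  D-to-Green (c , (p , q) , (r , s)) = c , (≤L-to-Green p , ≤L-to-Green q) , (≤R-to-Green r , ≤R-to-Green s)

rank : ∀ {n} → Subset n → Fin n → ℕ
rank (_       ∷ p) fzero    = 0
rank (inside  ∷ p) (fsuc i) = suc (rank p i)
rank (outside ∷ p) (fsuc i) = rank p i

rank<∣p∣ : ∀ {n} (p : Subset n) {i} → i ∈ p → rank p i <ℕ ∣ p ∣
rank<∣p∣ (inside  ∷ p) here       = s≤s z≤n
rank<∣p∣ (inside  ∷ p) (there i∈p) = s≤s (rank<∣p∣ p i∈p)
rank<∣p∣ (outside ∷ p) (there i∈p) = rank<∣p∣ p i∈p

rank-injective : ∀ {n} (p : Subset n) {i j} → i ∈ p → j ∈ p → rank p i ≡ rank p j → i ≡ j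
rank-injective (inside  ∷ p) here        here        _  = refl
rank-injective (inside  ∷ p) (there i∈p) (there j∈p) eq =
  cong fsuc (rank-injective p i∈p j∈p (suc-injective eq))
rank-injective (outside ∷ p) (there i∈p) (there j∈p) eq = cong fsuc (rank-injective p i∈p j∈p eq)

∣p∩q∣+∣p─q∣≡∣p∣ : ∀ {n} (p q : Subset n) → ∣ p ∩ q ∣ + ∣ p ─ q ∣ ≡ ∣ p ∣
∣p∩q∣+∣p─q∣≡∣p∣ []            []            = refl
∣p∩q∣+∣p─q∣≡∣p∣ (outside ∷ p) (inside  ∷ q) = ∣p∩q∣+∣p─q∣≡∣p∣ p q
∣p∩q∣+∣p─q∣≡∣p∣ (outside ∷ p) (outside ∷ q) = ∣p∩q∣+∣p─q∣≡∣p∣ p q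
∣p∩q∣+∣p─q∣≡∣p∣ (inside  ∷ p) (inside  ∷ q) = cong suc (∣p∩q∣+∣p─q∣≡∣p∣ p q)
∣p∩q∣+∣p─q∣≡∣p∣ (inside  ∷ p) (outside ∷ q) =
  trans (+-suc ∣ p ∩ q ∣ ∣ p ─ q ∣) (cong suc (∣p∩q∣+∣p─q∣≡∣p∣ p q))

x∈p─q⇒x∉q : ∀ {n} {p q : Subset n} {x} → x ∈ p ─ q → x ∉ q
x∈p─q⇒x∉q {p = _ ∷ p} {outside ∷ q} (there x∈p─q) (there x∈q) = x∈p─q⇒x∉q x∈p─q x∈q
x∈p─q⇒x∉q {p = _ ∷ p} {inside  ∷ q} (there x∈p─q) (there x∈q) = x∈p─q⇒x∉q x∈p─q x∈q

module Classical (em : ExcludedMiddle) where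

  by-contradiction : ∀ {P : Set} → ¬ ¬ P → P
  by-contradiction = decidable-stable (em _)

  abstract
    ε : ∀ {X : Set} → X → (X → Set) → X
    ε d P with em (∃ P)
    ... | yes (x , _) = x
    ... | no _        = d

    ε-spec : ∀ {X : Set} (d : X) (P : X → Set) → ∃ P → P (ε d P)
    ε-spec d P ∃P with em (∃ P)
    ... | yes (_ , Px) = Px
    ... | no ¬∃P       = ⊥-elim (¬∃P ∃P)

  does-em⁻ : ∀ {P : Set} → does (em P) ≡ true → P
  does-em⁻ {P} does≡true = by-contradiction λ ¬P → false≢true (trans (sym (dec-false (em P) ¬P)) does≡true)
    where
    false≢true : false ≢ true
    false≢true ()

  abstract
    ⟦_⟧ : ∀ {n} → (Fin n → Set) → Subset n
    ⟦ P ⟧ = tabulate (λ i → does (em (P i)))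

    ∈⟦⟧⁺ : ∀ {n} {P : Fin n → Set} {i} → P i → i ∈ ⟦ P ⟧
    ∈⟦⟧⁺ {P = P} {i} Pi = lookup⇒[]= i ⟦ P ⟧ (trans (lookup∘tabulate _ i) (dec-true (em (P i)) Pi))

    ∈⟦⟧⁻ : ∀ {n} {P : Fin n → Set} {i} → i ∈ ⟦ P ⟧ → P i
    ∈⟦⟧⁻ {i = i} i∈P = does-em⁻ (trans (sym (lookup∘tabulate _ i)) ([]=⇒lookup i∈P))

    ⟦⟧-cong : ∀ {n} {P Q : Fin n → Set} → (∀ i → P i ⇔ Q i) → ⟦ P ⟧ ≡ ⟦ Q ⟧
    ⟦⟧-cong {P = P} {Q} P⇔Q = tabulate-cong λ i → does-⇔ (P⇔Q i) (em (P i)) (em (Q i))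

module MinimalDClass (S : FiniteSemigroup) (E : Subset (FiniteSemigroup.size S)) where
  open FiniteSemigroup S
  open Green¹ S

  IsJMinimal : A → Set
  IsJMinimal d = d ∈ E × (∀ e → e ∈ E → e ≤J d → d ≤J e)

  ∃-J-minimal : ExcludedMiddle → ∀ {a} → a ∈ E → ∃ IsJMinimal
  ∃-J-minimal em {a} a∈E = descend (suc ∣ below a ∣) a∈E (n<1+n _)
    where
    open Classical em
    Below : A → A → Set
    Below a e = e ∈ E × e ≤J a
    below : A → Subset size
    below a = ⟦ Below a ⟧
    descend : ∀ n {a} → a ∈ E → ∣ below a ∣ <ℕ n → ∃ IsJMinimal
    descend (suc n) {a} a∈E (s≤s ∣below-a∣≤n) with em (∃[ e ] e ∈ E × e ≤J a × ¬ a ≤J e)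
    ... | no ¬smaller = a , a∈E , λ e e∈E e≤a → by-contradiction λ a≰e → ¬smaller (e , e∈E , e≤a , a≰e)
    ... | yes (e , e∈E , e≤a , a≰e) = descend n e∈E (<-≤-trans below-e⊂below-a ∣below-a∣≤n)
      where
      below-e⊂below-a : ∣ below e ∣ <ℕ ∣ below a ∣
      below-e⊂below-a = p⊂q⇒∣p∣<∣q∣
        ( (λ x∈ → let x∈E , x≤e = ∈⟦⟧⁻ {P = Below e} x∈ in ∈⟦⟧⁺ (x∈E , ≤J-trans x≤e e≤a))
        , a , ∈⟦⟧⁺ (a∈E , ≤J-refl) , λ a∈ → a≰e (proj₂ (∈⟦⟧⁻ {P = Below e} a∈)))

  module _ {d} (d-minimal : IsJMinimal d) where

    D-absorbs : ∀ {a b} → d D a → b ≤J a → b ∈ E → d D b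
    D-absorbs d-D-a b≤a b∈E = D-sym (≤J-antisym⇒D b≤d (proj₂ d-minimal _ b∈E b≤d))
      where b≤d = ≤J-trans b≤a (D⇒≤J (D-sym d-D-a))

    D-absorbsʳ : ∀ {a} x → d D a → a · x ∈ E → d D a · x
    D-absorbsʳ x d-D-a = D-absorbs d-D-a (nothing , just x , refl)

    D-absorbsˡ : ∀ {a} x → d D a → x · a ∈ E → d D x · a
    D-absorbsˡ x d-D-a = D-absorbs d-D-a (just x , nothing , refl)

module Order (α : LinearOrdering) where
  open LO α
  open IsStrictTotalOrder isSTO public using (compare) renaming (trans to <-trans)

  <-irrefl : ∀ {x} → ¬ x < x
  <-irrefl = IsStrictTotalOrder.irrefl isSTO refl

  ≼-refl : ∀ {x} → x ≼ x
  ≼-refl = inj₂ refl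

  ≼-<-trans : ∀ {x y z} → x ≼ y → y < z → x < z
  ≼-<-trans (inj₁ x<y)  y<z = <-trans x<y y<z
  ≼-<-trans (inj₂ refl) y<z = y<z

  <-≼-trans : ∀ {x y z} → x < y → y ≼ z → x < z
  <-≼-trans x<y (inj₁ y<z)  = <-trans x<y y<z
  <-≼-trans x<y (inj₂ refl) = x<y

  ≼-trans : ∀ {x y z} → x ≼ y → y ≼ z → x ≼ z
  ≼-trans (inj₁ x<y)  y≼z = inj₁ (<-≼-trans x<y y≼z)
  ≼-trans (inj₂ refl) y≼z = y≼z

  <⇒⋡ : ∀ {x y} → x < y → ¬ y ≼ x
  <⇒⋡ x<y y≼x = <-irrefl (<-≼-trans x<y y≼x)

  ⋠⇒> : ∀ {x y} → ¬ x ≼ y → y < x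
  ⋠⇒> {x} {y} x⋠y with compare x y
  ... | tri< x<y _ _ = ⊥-elim (x⋠y (inj₁ x<y))
  ... | tri≈ _ x≡y _ = ⊥-elim (x⋠y (inj₂ x≡y))
  ... | tri> _ _ y<x = y<x

  ≼-antisym : ∀ {x y} → x ≼ y → y ≼ x → x ≡ y
  ≼-antisym (inj₁ x<y)  y≼x = ⊥-elim (<⇒⋡ x<y y≼x)
  ≼-antisym (inj₂ x≡y) _    = x≡y

  _<[_]_ : Carrier → Pred → Carrier → Set
  y <[ β ] x = β y × y < x

  wellOrdered⇒wellFounded : ExcludedMiddle → ∀ {β} → WellOrdered β → WellFounded (_<[ β ]_)
  wellOrdered⇒wellFounded em {β} β-wo x = acc λ (βy , _) → acc-β βy
    where
    open Classical em
    -- The least element of β that is not accessible would be accessible.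
    acc-β : ∀ {x} → β x → Acc (_<[ β ]_) x
    acc-β {x} βx = by-contradiction λ ¬acc-x →
      let m , (_ , ¬acc-m) , m-least = β-wo (λ z → β z × ¬ Acc (_<[ β ]_) z) (λ _ → proj₁) (x , βx , ¬acc-x)
      in ¬acc-m (acc λ {y} (βy , y<m) → by-contradiction λ ¬acc-y → <⇒⋡ y<m (m-least y (βy , ¬acc-y)))

module _ (α : LinearOrdering) (S : FiniteSemigroup)
  (σ : LinearOrdering.Carrier α → LinearOrdering.Carrier α → Fin (FiniteSemigroup.size S)) where
  open Labelling α S

  IsRamseyanSplit : LO.Pred α → ℕ → (LinearOrdering.Carrier α → ℕ) → Set
  IsRamseyanSplit γ N s = IsSplit γ N s × Ramseyan σ γ s

module Construction
  (em : ExcludedMiddle) (S : FiniteSemigroup) (α : LinearOrdering)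
  (σ : LinearOrdering.Carrier α → LinearOrdering.Carrier α → Fin (FiniteSemigroup.size S))
  (additive : Labelling.IsAdditive α S σ)
  (E : Subset (FiniteSemigroup.size S)) (E-closed : Green.DClosed S E)
  (d₀ : Fin (FiniteSemigroup.size S)) (d₀-minimal : MinimalDClass.IsJMinimal S E d₀)
  (β : LO.Pred α) (β-wo : LO.WellOrdered α β) (σβ⊆E : Labelling.ImageIn α S σ β E)
  (b₀ : LinearOrdering.Carrier α) (b₀-least : LO.IsLeast α β b₀)
  where
  open FiniteSemigroup S
  open Green¹ S
  open MinimalDClass S E using (D-absorbsʳ; D-absorbsˡ)
  open LO α
  open Order α
  open Labelling α S
  open Classical em

  D₀ : A → Set
  D₀ a = d₀ D a

  D₀⊆E : ∀ {a} → D₀ a → a ∈ E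
  D₀⊆E d₀-D-a = E-closed d₀ _ (D-to-Green d₀-D-a) (proj₁ d₀-minimal)

  D₀-D : ∀ {a b} → D₀ a → D₀ b → a D b
  D₀-D d₀-D-a d₀-D-b = D-trans (D-sym d₀-D-a) d₀-D-b

  module _ {x y z} (βx : β x) (βz : β z) (x<y : x < y) (y<z : y < z) where
    private
      σxz∈E : σ x y · σ y z ∈ E
      σxz∈E = subst (_∈ E) (sym (additive x y z x<y y<z)) (σβ⊆E x z βx βz (<-trans x<y y<z))

    D₀-σʳ : D₀ (σ x y) → D₀ (σ x z)
    D₀-σʳ h = subst D₀ (additive x y z x<y y<z) (D-absorbsʳ d₀-minimal (σ y z) h σxz∈E)

    D₀-σˡ : D₀ (σ y z) → D₀ (σ x z)
    D₀-σˡ h = subst D₀ (additive x y z x<y y<z) (D-absorbsˡ d₀-minimal (σ x y) h σxz∈E)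

  private
    β-wf : WellFounded (_<[ β ]_)
    β-wf = wellOrdered⇒wellFounded em β-wo

    CutCondition : (x : Carrier) → (∀ {c} → c <[ β ] x → Set) → Set
    CutCondition x IsCut< = ∀ c (c<x : c <[ β ] x) → IsCut< c<x → D₀ (σ c x)

    cut-step : ∀ x → WfRec (_<[ β ]_) (λ _ → Bool) x → Bool
    cut-step x cut< = does (em (CutCondition x (λ c<x → cut< c<x ≡ true)))

    cut-step-ext : ∀ x {cut< cut<′ : WfRec (_<[ β ]_) (λ _ → Bool) x} →
                   (∀ {c} (c<x : c <[ β ] x) → cut< c<x ≡ cut<′ c<x) → cut-step x cut< ≡ cut-step x cut<′
    cut-step-ext x eq = does-⇔
      (mk⇔ (λ h c c<x e → h c c<x (trans (eq c<x) e)) (λ h c c<x e → h c c<x (trans (sym (eq c<x)) e)))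
      (em _) (em _)

  -- x ∈ β is a cut iff σ(c, x) ∈ D₀ for every cut c < x in β.  The recursion is Bool-valued (via em)
  -- so that its unfolding equation needs no extensionality for Set.
  abstract
    cut : Carrier → Bool
    cut = All.wfRec β-wf 0ℓ (λ _ → Bool) cut-step

    cut-unfold : ∀ {x} → cut x ≡ cut-step x (λ {c} _ → cut c)
    cut-unfold = FixPoint.unfold-wfRec β-wf (λ _ → Bool) cut-step cut-step-ext

  IsCut : Carrier → Set
  IsCut x = cut x ≡ true

  cut? : ∀ x → Dec (IsCut x)
  cut? x = cut x ≟ᵇ true

  IsCut⇒ : ∀ {x} → IsCut x → ∀ c → β c → c < x → IsCut c → D₀ (σ c x)
  IsCut⇒ x-cut c βc c<x = does-em⁻ (trans (sym cut-unfold) x-cut) c (βc , c<x)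

  ⇒IsCut : ∀ {x} → (∀ c → β c → c < x → IsCut c → D₀ (σ c x)) → IsCut x
  ⇒IsCut h = trans cut-unfold (dec-true (em _) (λ c (βc , c<x) → h c βc c<x))

  βb₀ : β b₀
  βb₀ = proj₁ b₀-least

  b₀-cut : IsCut b₀
  b₀-cut = ⇒IsCut λ c βc c<b₀ _ → ⊥-elim (<⇒⋡ c<b₀ (proj₂ b₀-least c βc))

  b₀<dot : ∀ {x} → dot β x → b₀ < x
  b₀<dot (_ , y , βy , y<x) = ≼-<-trans (proj₂ b₀-least y βy) y<x

  record LastCut (z c : Carrier) : Set where
    constructor is-last
    field
      last∈β   : β c
      last-cut : IsCut c
      last≼    : c ≼ z
      last-max : ∀ c′ → β c′ → IsCut c′ → c′ ≼ z → c′ ≼ c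
  open LastCut

  lastCut-unique : ∀ {z c c′} → LastCut z c → LastCut z c′ → c ≡ c′
  lastCut-unique c-last c′-last =
    ≼-antisym (last-max c′-last _ (last∈β c-last) (last-cut c-last) (last≼ c-last))
              (last-max c-last _ (last∈β c′-last) (last-cut c′-last) (last≼ c′-last))

  -- Without a last cut ≤ z, let μ be the least point of β above all cuts ≤ z.  As μ is not a cut,
  -- σ(c, μ) ∉ D₀ for some cut c < μ; but some cut c′ ≤ z lies above c, and σ(c, c′) ∈ D₀ absorbs.
  private module NoLastCut {z} (βz : β z) (¬last : ¬ ∃ (LastCut z)) where

    Above : Pred
    Above w = β w × (∀ c → β c → IsCut c → c ≼ z → c < w)

    z-above : Above z
    z-above = βz , λ where
      c βc c-cut (inj₁ c<z)  → c<z
      c βc c-cut (inj₂ refl) → ⊥-elim (¬last (c , is-last βc c-cut ≼-refl λ _ _ _ c′≼z → c′≼z))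

    some-cut-misses : ∀ {μ} → Above μ → μ ≼ z → ∃[ c ] β c × c < μ × IsCut c × ¬ D₀ (σ c μ)
    some-cut-misses {μ} (βμ , μ-above) μ≼z = by-contradiction λ none →
      <-irrefl (μ-above μ βμ (⇒IsCut λ c βc c<μ c-cut → by-contradiction λ σcμ∉D₀ →
        none (c , βc , c<μ , c-cut , σcμ∉D₀)) μ≼z)

    later-cut : ∀ {c} → β c → IsCut c → c ≼ z → ∃[ c′ ] β c′ × IsCut c′ × c′ ≼ z × c < c′
    later-cut βc c-cut c≼z = by-contradiction λ none →
      ¬last (_ , is-last βc c-cut c≼z λ c′ βc′ c′-cut c′≼z → by-contradiction λ c′⋠c →
        none (c′ , βc′ , c′-cut , c′≼z , ⋠⇒> c′⋠c))

    absurd : ⊥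
    absurd
      with μ , (βμ , μ-above) , μ-least ← β-wo Above (λ _ → proj₁) (z , z-above)
      with μ≼z ← μ-least z z-above
      with c , βc , c<μ , c-cut , σcμ∉D₀ ← some-cut-misses (βμ , μ-above) μ≼z
      with c′ , βc′ , c′-cut , c′≼z , c<c′ ← later-cut βc c-cut (inj₁ (<-≼-trans c<μ μ≼z))
      = σcμ∉D₀ (D₀-σʳ βc βμ c<c′ (μ-above c′ βc′ c′-cut c′≼z) (IsCut⇒ c′-cut c βc c<c′ c-cut))

  ∃-lastCut : ∀ {z} → β z → ∃ (LastCut z)
  ∃-lastCut βz = by-contradiction (NoLastCut.absurd βz)

  lastCut : Carrier → Carrier
  lastCut z = ε z (LastCut z)

  lastCut-spec : ∀ {z} → β z → LastCut z (lastCut z)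
  lastCut-spec {z} βz = ε-spec z (LastCut z) (∃-lastCut βz)

  Segment : Carrier → Pred
  Segment c z = β z × c ≼ z × (∀ c′ → β c′ → IsCut c′ → c < c′ → z < c′)

  dot-Segment⇒dot : ∀ {c z} → dot (Segment c) z → dot β z
  dot-Segment⇒dot ((βz , _) , y , (βy , _) , y<z) = βz , y , βy , y<z

  module _ {x} (βx : β x) (x-noncut : ¬ IsCut x) where

    lastCut<noncut : lastCut x < x
    lastCut<noncut = case last≼ (lastCut-spec βx) of λ
      { (inj₁ c<x) → c<x
      ; (inj₂ c≡x) → ⊥-elim (x-noncut (subst IsCut c≡x (last-cut (lastCut-spec βx))))
      }

    noncut∈Segment : dot (Segment (lastCut x)) x
    noncut∈Segment =
      (βx , inj₁ lastCut<noncut , λ c′ βc′ c′-cut c<c′ → ⋠⇒> λ c′≼x → <⇒⋡ c<c′ (last-max c-last c′ βc′ c′-cut c′≼x)) ,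
      lastCut x , (last∈β c-last , ≼-refl , λ _ _ _ c<c′ → c<c′) , lastCut<noncut
      where c-last = lastCut-spec βx

  module _ {c} (βc : β c) (c-cut : IsCut c) where

    Segment⇒noncut : ∀ {z} → dot (Segment c) z → ¬ IsCut z
    Segment⇒noncut {z} ((βz , _ , z-below) , y , (_ , c≼y , _) , y<z) z-cut =
      <-irrefl (z-below z βz z-cut (≼-<-trans c≼y y<z))

    Segment⇒lastCut : ∀ {z} → dot (Segment c) z → lastCut z ≡ c
    Segment⇒lastCut {z} ((βz , c≼z , z-below) , _) = lastCut-unique (lastCut-spec βz) (is-last βc c-cut c≼z c-last)
      where
      c-last : ∀ c′ → β c′ → IsCut c′ → c′ ≼ z → c′ ≼ c
      c-last c′ βc′ c′-cut c′≼z with compare c c′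
      ... | tri< c<c′ _ _ = ⊥-elim (<⇒⋡ (z-below c′ βc′ c′-cut c<c′) c′≼z)
      ... | tri≈ _ c≡c′ _ = inj₂ (sym c≡c′)
      ... | tri> _ _ c′<c = inj₁ c′<c

    -- A label in D₀ inside the segment of c would make its right end a cut.
    Segment-label∉D₀ : ∀ {u v} → Segment c u → Segment c v → u < v → ¬ D₀ (σ u v)
    Segment-label∉D₀ {u} {v} (_ , c≼u , _) (βv , _ , v-below) u<v σuv∈D₀ =
      <-irrefl (v-below v βv v-cut c<v)
      where
      c<v = ≼-<-trans c≼u u<v
      σcv∈D₀ : D₀ (σ c v)
      σcv∈D₀ = case c≼u of λ
        { (inj₁ c<u) → D₀-σˡ βc βv c<u u<v σuv∈D₀
        ; (inj₂ c≡u) → subst (λ z → D₀ (σ z v)) (sym c≡u) σuv∈D₀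
        }
      v-cut : IsCut v
      v-cut = ⇒IsCut λ c′ βc′ c′<v c′-cut → case compare c c′ of λ where
        (tri< c<c′ _ _) → ⊥-elim (<⇒⋡ c′<v (inj₁ (v-below c′ βc′ c′-cut c<c′)))
        (tri≈ _ refl _) → σcv∈D₀
        (tri> _ _ c′<c) → D₀-σˡ βc′ βv c′<c c<v σcv∈D₀

  Segment-wellOrdered : ∀ c → WellOrdered (Segment c)
  Segment-wellOrdered c P P⊆Segment = β-wo P (λ x Px → proj₁ (P⊆Segment x Px))

  E′ : Subset size
  E′ = E ─ ⟦ D₀ ⟧

  E′-closed : Green.DClosed S E′
  E′-closed a b a-D-b a∈E′ = x∈p∧x∉q⇒x∈p─q (E-closed a b a-D-b (p─q⊆p E ⟦ D₀ ⟧ a∈E′)) λ b∈D₀ →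
    x∈p─q⇒x∉q a∈E′ (∈⟦⟧⁺ (D-trans (∈⟦⟧⁻ b∈D₀) (D-sym (D-of-Green a-D-b))))

  σ-Segment⊆E′ : ∀ {c} → β c → IsCut c → ImageIn σ (Segment c) E′
  σ-Segment⊆E′ βc c-cut u v u∈ v∈ u<v = x∈p∧x∉q⇒x∈p─q (σβ⊆E u v (proj₁ u∈) (proj₁ v∈) u<v) λ σuv∈D₀ →
    Segment-label∉D₀ βc c-cut u∈ v∈ u<v (∈⟦⟧⁻ σuv∈D₀)

  ∣D₀∣+∣E′∣≤∣E∣ : ∣ ⟦ D₀ ⟧ ∣ + ∣ E′ ∣ ≤ℕ ∣ E ∣
  ∣D₀∣+∣E′∣≤∣E∣ = ≤-trans (+-monoˡ-≤ ∣ E′ ∣ (p⊆q⇒∣p∣≤∣q∣ λ a∈D₀ → x∈p∩q⁺ (D₀⊆E (∈⟦⟧⁻ a∈D₀) , a∈D₀)))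
                          (≤-reflexive (∣p∩q∣+∣p─q∣≡∣p∣ E ⟦ D₀ ⟧))

  ∣E′∣<∣E∣ : ∣ E′ ∣ <ℕ ∣ E ∣
  ∣E′∣<∣E∣ = ≤-trans (+-monoˡ-≤ ∣ E′ ∣ (≤-trans (s≤s z≤n) (rank<∣p∣ ⟦ D₀ ⟧ (∈⟦⟧⁺ D-refl)))) ∣D₀∣+∣E′∣≤∣E∣

  prefix : Carrier → A
  prefix x = σ b₀ x

  prefix∈D₀ : ∀ {x} → dot β x → IsCut x → D₀ (prefix x)
  prefix∈D₀ x∈ x-cut = IsCut⇒ x-cut b₀ βb₀ (b₀<dot x∈) b₀-cut

  σ-later-cuts-R : ∀ {c y y′} → β c → IsCut c → β y → IsCut y → β y′ → IsCut y′ →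
                   c < y → c < y′ → σ c y R σ c y′
  σ-later-cuts-R {c} {y} {y′} βc c-cut βy y-cut βy′ y′-cut c<y c<y′ = case compare y y′ of λ
    { (tri< y<y′ _ _) → ordered y-cut y′-cut c<y y<y′
    ; (tri≈ _ refl _) → R-refl
    ; (tri> _ _ y′<y) → R-sym (ordered y′-cut y-cut c<y′ y′<y)
    }
    where
    ordered : ∀ {y y′} → IsCut y → IsCut y′ → c < y → y < y′ → σ c y R σ c y′
    ordered {y} {y′} y-cut y′-cut c<y y<y′ = subst (σ c y R_) σcy·σyy′≡σcy′ (D-stableʳ _ _
      (subst (σ c y D_) (sym σcy·σyy′≡σcy′)
        (D₀-D (IsCut⇒ y-cut c βc c<y c-cut) (IsCut⇒ y′-cut c βc (<-trans c<y y<y′) c-cut))))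
      where σcy·σyy′≡σcy′ = additive c y y′ c<y y<y′

  prefix-R : ∀ {x x′} → dot β x → IsCut x → dot β x′ → IsCut x′ → prefix x R prefix x′
  prefix-R x∈ x-cut x′∈ x′-cut = σ-later-cuts-R βb₀ b₀-cut (proj₁ x∈) x-cut (proj₁ x′∈) x′-cut (b₀<dot x∈) (b₀<dot x′∈)

  RepresentsPrefixes : A → Set
  RepresentsPrefixes a = ∀ x → dot β x → IsCut x → prefix x R a

  a₀ : A
  a₀ = ε d₀ RepresentsPrefixes

  prefix-R-a₀ : ∀ {x} → dot β x → IsCut x → prefix x R a₀
  prefix-R-a₀ {x} x∈ x-cut = ε-spec d₀ RepresentsPrefixes (prefix x , λ x′ x′∈ x′-cut → prefix-R x′∈ x′-cut x∈ x-cut) x x∈ x-cut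

  a₀∈D₀ : ∀ {x} → dot β x → IsCut x → D₀ a₀
  a₀∈D₀ x∈ x-cut = D-trans (prefix∈D₀ x∈ x-cut) (R⇒D (prefix-R-a₀ x∈ x-cut))

  RepresentsRightLabels : Carrier → A → Set
  RepresentsRightLabels x a = D₀ a × (∀ y → β y → IsCut y → x < y → σ x y R a)

  rightRep : Carrier → A
  rightRep x = ε d₀ (RepresentsRightLabels x)

  rightRep-spec : ∀ {x} → dot β x → IsCut x → RepresentsRightLabels x (rightRep x)
  rightRep-spec {x} x∈@(βx , _) x-cut = ε-spec d₀ (RepresentsRightLabels x) (case em (∃[ y ] β y × IsCut y × x < y) of λ
    { (yes (y , βy , y-cut , x<y)) →
        σ x y , IsCut⇒ y-cut x βx x<y x-cut ,
        λ y′ βy′ y′-cut x<y′ → σ-later-cuts-R βx x-cut βy′ y′-cut βy y-cut x<y′ x<y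
    ; (no ¬later) → prefix x , prefix∈D₀ x∈ x-cut , λ y βy y-cut x<y → ⊥-elim (¬later (y , βy , y-cut , x<y))
    })

  -- u ◃_ maps the 𝓡-class of a₀ into C, and v ∙_ undoes it.
  Translation : Subset size → S¹ × S¹ → Set
  Translation C (u , v) = u ◃ a₀ ∈ C × just a₀ ≡ v ∙ just (u ◃ a₀)

  ∃-translation : ∀ {a} → D₀ a₀ → D₀ a → ∃ (Translation ⟦ _R a ⟧)
  ∃-translation {a} a₀∈D₀ a∈D₀ =
    let c , ((v , a₀≡vc) , (u , c≡ua₀)) , c-R-a = D₀-D a₀∈D₀ a∈D₀
        ua₀≡c = just-injective (trans (◃-∙ u a₀) (sym c≡ua₀))
    in (u , v) , ∈⟦⟧⁺ (subst (_R a) (sym ua₀≡c) c-R-a) , subst (λ z → just a₀ ≡ v ∙ just z) (sym ua₀≡c) a₀≡vc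

  translation : Subset size → S¹ × S¹
  translation C = ε (nothing , nothing) (Translation C)

  -- A Subset rather than an element, so that points with 𝓡-related rightRep get equal translations.
  rightClass : Carrier → Subset size
  rightClass x = ⟦ _R rightRep x ⟧

  code : Carrier → A
  code x = proj₁ (translation (rightClass x)) ◃ prefix x

  module _ {x} (x∈ : dot β x) (x-cut : IsCut x) where
    private
      u = proj₁ (translation (rightClass x))
      v = proj₂ (translation (rightClass x))
      u,v-translate : Translation (rightClass x) (u , v)
      u,v-translate = ε-spec (nothing , nothing) (Translation (rightClass x)) (∃-translation (a₀∈D₀ x∈ x-cut) (proj₁ (rightRep-spec x∈ x-cut)))

    code-R-rightRep : code x R rightRep x
    code-R-rightRep = R-trans (◃-cong-R u (prefix-R-a₀ x∈ x-cut)) (∈⟦⟧⁻ (proj₁ u,v-translate))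

    code∈D₀ : D₀ (code x)
    code∈D₀ = D-trans (proj₁ (rightRep-spec x∈ x-cut)) (R⇒D (R-sym code-R-rightRep))

    prefix-from-code : just (prefix x) ≡ proj₂ (translation (rightClass x)) ∙ just (code x)
    prefix-from-code = ◃-inverse-≤R {u} {v} (proj₂ u,v-translate) (proj₁ (prefix-R-a₀ x∈ x-cut))

  code-injective : ∀ {x x′} → dot β x → IsCut x → dot β x′ → IsCut x′ → code x ≡ code x′ →
                   prefix x ≡ prefix x′ × rightRep x R rightRep x′
  code-injective {x} {x′} x∈ x-cut x′∈ x′-cut code≡ = just-injective (begin
      just (prefix x)                                       ≡⟨ prefix-from-code x∈ x-cut ⟩
      proj₂ (translation (rightClass x)) ∙ just (code x) ≡⟨ cong₂ (λ C c → proj₂ (translation C) ∙ just c) same-class code≡ ⟩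
      proj₂ (translation (rightClass x′)) ∙ just (code x′) ≡⟨ prefix-from-code x′∈ x′-cut ⟨
      just (prefix x′)                                      ∎) ,
    rep-R-rep′
    where
    open ≡-Reasoning
    rep-R-rep′ : rightRep x R rightRep x′
    rep-R-rep′ = R-trans (R-sym (code-R-rightRep x∈ x-cut)) (subst (_R rightRep x′) (sym code≡) (code-R-rightRep x′∈ x′-cut))
    same-class : rightClass x ≡ rightClass x′
    same-class = ⟦⟧-cong λ a → mk⇔ (λ a-R-rep → R-trans a-R-rep rep-R-rep′) (λ a-R-rep′ → R-trans a-R-rep′ (R-sym rep-R-rep′))

  -- σ(b₀, y) = σ(b₀, x) σ(x, y) and equal codes give σ(b₀, y) = σ(b₀, x): so σ(x, y) is absorbed by
  -- σ(b₀, x), to whose 𝓛-class it belongs by stability.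
  σ-equal-codes : ∀ {x y} → dot β x → IsCut x → dot β y → IsCut y → x < y → code x ≡ code y →
                  IsIdempotent (σ x y) × σ x y R rightRep x × σ x y L prefix x
  σ-equal-codes {x} {y} x∈ x-cut y∈ y-cut x<y code≡ =
    idempotent-absorbed prefix·σ≡prefix (proj₁ σ-L-prefix) , proj₂ (rightRep-spec x∈ x-cut) y (proj₁ y∈) y-cut x<y , σ-L-prefix
    where
    prefix·σ≡prefix : prefix x · σ x y ≡ prefix x
    prefix·σ≡prefix = trans (additive b₀ x y (b₀<dot x∈) x<y) (sym (proj₁ (code-injective x∈ x-cut y∈ y-cut code≡)))
    σ-L-prefix : σ x y L prefix x
    σ-L-prefix = subst (σ x y L_) prefix·σ≡prefix (D-stableˡ (prefix x) (σ x y) (subst (σ x y D_) (sym prefix·σ≡prefix)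
      (D₀-D (IsCut⇒ y-cut x (proj₁ x∈) x<y x-cut) (prefix∈D₀ x∈ x-cut))))

  equal-codes⇒ramsey : ∀ {x y x′ y′} → dot β x → IsCut x → dot β y → IsCut y → dot β x′ → IsCut x′ →
    dot β y′ → IsCut y′ → x < y → x′ < y′ → code x ≡ code y → code x ≡ code x′ → code x′ ≡ code y′ →
    σ x y ≡ σ x′ y′ × σ x y ≡ σ x y · σ x y
  equal-codes⇒ramsey x∈ x-cut y∈ y-cut x′∈ x′-cut y′∈ y′-cut x<y x′<y′ xy≡ xx′≡ x′y′≡ =
    let idem  , σ-R-rep   , σ-L-prefix  = σ-equal-codes x∈ x-cut y∈ y-cut x<y xy≡
        idem′ , σ′-R-rep′ , σ′-L-prefix′ = σ-equal-codes x′∈ x′-cut y′∈ y′-cut x′<y′ x′y′≡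
        prefix≡prefix′ , rep-R-rep′      = code-injective x∈ x-cut x′∈ x′-cut xx′≡
    in idempotent-ℋ-unique idem idem′ (R-trans σ-R-rep (R-trans rep-R-rep′ (R-sym σ′-R-rep′)))
                                     (L-trans σ-L-prefix (subst (_L σ _ _) (sym prefix≡prefix′) (L-sym σ′-L-prefix′))) ,
       sym idem

  n₀ : ℕ
  n₀ = ∣ ⟦ D₀ ⟧ ∣

  module Split (IH : ∀ β′ → WellOrdered β′ → ImageIn σ β′ E′ → ∃ (IsRamseyanSplit α S σ (dot β′) ∣ E′ ∣)) where

    segmentSplit : Carrier → Carrier → ℕ
    segmentSplit c = ε (λ _ → 0) (IsRamseyanSplit α S σ (dot (Segment c)) ∣ E′ ∣)

    segmentSplit-spec : ∀ {c} → β c → IsCut c → IsRamseyanSplit α S σ (dot (Segment c)) ∣ E′ ∣ (segmentSplit c)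
    segmentSplit-spec {c} βc c-cut = ε-spec (λ _ → 0) (IsRamseyanSplit α S σ (dot (Segment c)) ∣ E′ ∣)
      (IH (Segment c) (Segment-wellOrdered c) (σ-Segment⊆E′ βc c-cut))

    level : Carrier → Bool → ℕ
    level x true  = suc (rank ⟦ D₀ ⟧ (code x))
    level x false = n₀ + segmentSplit (lastCut x) x

    s : Carrier → ℕ
    s x = level x (cut x)

    s-cut : ∀ {x} → IsCut x → s x ≡ suc (rank ⟦ D₀ ⟧ (code x))
    s-cut {x} x-cut = cong (level x) x-cut

    s-noncut : ∀ {x} → ¬ IsCut x → s x ≡ n₀ + segmentSplit (lastCut x) x
    s-noncut {x} x-noncut = cong (level x) (¬-not x-noncut)

    s-cut≤n₀ : ∀ {x} → dot β x → IsCut x → s x ≤ℕ n₀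
    s-cut≤n₀ x∈ x-cut = subst (_≤ℕ n₀) (sym (s-cut x-cut)) (rank<∣p∣ ⟦ D₀ ⟧ (∈⟦⟧⁺ (code∈D₀ x∈ x-cut)))

    segmentSplit-noncut : ∀ {x} → dot β x → ¬ IsCut x → 1 ≤ℕ segmentSplit (lastCut x) x × segmentSplit (lastCut x) x ≤ℕ ∣ E′ ∣
    segmentSplit-noncut {x} (βx , _) x-noncut =
      proj₁ (segmentSplit-spec (last∈β c-last) (last-cut c-last)) x (noncut∈Segment βx x-noncut)
      where c-last = lastCut-spec βx

    n₀<s-noncut : ∀ {x} → dot β x → ¬ IsCut x → n₀ <ℕ s x
    n₀<s-noncut x∈ x-noncut = subst (n₀ <ℕ_) (sym (s-noncut x-noncut))
      (m<m+n n₀ (proj₁ (segmentSplit-noncut x∈ x-noncut)))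

    s-isSplit : IsSplit (dot β) ∣ E ∣ s
    s-isSplit x x∈ with cut? x
    ... | yes x-cut  = subst (1 ≤ℕ_) (sym (s-cut x-cut)) (s≤s z≤n) ,
                       ≤-trans (s-cut≤n₀ x∈ x-cut) (≤-trans (m≤m+n n₀ ∣ E′ ∣) ∣D₀∣+∣E′∣≤∣E∣)
    ... | no x-noncut = subst (1 ≤ℕ_) (sym (s-noncut x-noncut)) (≤-trans 1≤t (m≤n+m _ n₀)) ,
                        subst (_≤ℕ ∣ E ∣) (sym (s-noncut x-noncut)) (≤-trans (+-monoʳ-≤ n₀ t≤E′) ∣D₀∣+∣E′∣≤∣E∣)
      where
      1≤t = proj₁ (segmentSplit-noncut x∈ x-noncut)
      t≤E′ = proj₂ (segmentSplit-noncut x∈ x-noncut)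

    module _ {k} (n₀<k : n₀ <ℕ k) where

      -- A cut strictly between two points would sit at a level ≤ n₀ < k.
      same-lastCut< : ∀ {u v} → dot β u → dot β v → ¬ IsCut u → ¬ IsCut v → u < v →
                      (∀ z → dot β z → u ≼ z → z ≼ v → k ≤ℕ s z) → lastCut u ≡ lastCut v
      same-lastCut< {u} {v} (βu , _) (βv , _) u-noncut v-noncut u<v k≤between = case c≼c′ of λ
        { (inj₂ c≡c′) → c≡c′
        ; (inj₁ c<c′) → ⊥-elim (<⇒≱ n₀<k (≤-trans
            (k≤between c′ (c′∈ c<c′) (inj₁ (u<c′ c<c′)) (inj₁ (lastCut<noncut βv v-noncut)))
            (s-cut≤n₀ (c′∈ c<c′) (last-cut c′-last))))
        }
        where
        c′ = lastCut v
        c-last = lastCut-spec βu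
        c′-last = lastCut-spec βv
        c≼c′ : lastCut u ≼ c′
        c≼c′ = last-max c′-last _ (last∈β c-last) (last-cut c-last) (≼-trans (last≼ c-last) (inj₁ u<v))
        c′∈ : lastCut u < c′ → dot β c′
        c′∈ c<c′ = last∈β c′-last , lastCut u , last∈β c-last , c<c′
        u<c′ : lastCut u < c′ → u < c′
        u<c′ c<c′ = ⋠⇒> λ c′≼u → <⇒⋡ c<c′ (last-max c-last _ (last∈β c′-last) (last-cut c′-last) c′≼u)

      neighbours-same-lastCut : ∀ {u v} → Neighbours (dot β) s k u v → ¬ IsCut u → ¬ IsCut v → lastCut u ≡ lastCut v
      neighbours-same-lastCut {u} {v} (u∈ , v∈ , _ , _ , k≤between) u-noncut v-noncut with compare u v
      ... | tri< u<v _ _ = same-lastCut< u∈ v∈ u-noncut v-noncut u<v λ z z∈ u≼z z≼v → k≤between z z∈ (inj₁ (u≼z , z≼v))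
      ... | tri≈ _ refl _ = refl
      ... | tri> _ _ v<u = sym (same-lastCut< v∈ u∈ v-noncut u-noncut v<u λ z z∈ v≼z z≼u → k≤between z z∈ (inj₂ (v≼z , z≼u)))

      neighbours-in-Segment : ∀ {c u v} → β c → IsCut c → Neighbours (dot β) s k u v → ¬ IsCut u → ¬ IsCut v →
        lastCut u ≡ c → lastCut v ≡ c → Neighbours (dot (Segment c)) (segmentSplit c) (k ∸ n₀) u v
      neighbours-in-Segment {c} βc c-cut (u∈ , v∈ , su≡k , sv≡k , k≤between) u-noncut v-noncut lu≡c lv≡c =
        in-Segment u∈ u-noncut lu≡c , in-Segment v∈ v-noncut lv≡c ,
        local-level u-noncut lu≡c su≡k , local-level v-noncut lv≡c sv≡k ,
        λ z z∈ between → local-bound z∈ (k≤between z (dot-Segment⇒dot z∈) between)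
        where
        in-Segment : ∀ {x} → dot β x → ¬ IsCut x → lastCut x ≡ c → dot (Segment c) x
        in-Segment {x} (βx , _) x-noncut lx≡c = subst (λ c → dot (Segment c) x) lx≡c (noncut∈Segment βx x-noncut)
        local-level : ∀ {x} → ¬ IsCut x → lastCut x ≡ c → s x ≡ k → segmentSplit c x ≡ k ∸ n₀
        local-level {x} x-noncut lx≡c sx≡k = begin
          segmentSplit c x                       ≡⟨ m+n∸m≡n n₀ _ ⟨
          n₀ + segmentSplit c x ∸ n₀             ≡⟨ cong (λ c′ → n₀ + segmentSplit c′ x ∸ n₀) lx≡c ⟨
          n₀ + segmentSplit (lastCut x) x ∸ n₀   ≡⟨ cong (_∸ n₀) (trans (sym (s-noncut x-noncut)) sx≡k) ⟩
          k ∸ n₀                                 ∎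
          where open ≡-Reasoning
        local-bound : ∀ {z} → dot (Segment c) z → k ≤ℕ s z → k ∸ n₀ ≤ℕ segmentSplit c z
        local-bound {z} z∈ k≤sz = subst (k ∸ n₀ ≤ℕ_) sz∸n₀≡ (∸-monoˡ-≤ n₀ k≤sz)
          where
          sz∸n₀≡ : s z ∸ n₀ ≡ segmentSplit c z
          sz∸n₀≡ = trans (cong (_∸ n₀) (trans (s-noncut (Segment⇒noncut βc c-cut z∈))
                                             (cong (λ c′ → n₀ + segmentSplit c′ z) (Segment⇒lastCut βc c-cut z∈))))
                         (m+n∸m≡n n₀ _)

    equal-levels⇒equal-codes : ∀ {u v} → dot β u → IsCut u → dot β v → IsCut v → s u ≡ s v → code u ≡ code v
    equal-levels⇒equal-codes u∈ u-cut v∈ v-cut su≡sv =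
      rank-injective ⟦ D₀ ⟧ (∈⟦⟧⁺ (code∈D₀ u∈ u-cut)) (∈⟦⟧⁺ (code∈D₀ v∈ v-cut))
        (suc-injective (trans (sym (s-cut u-cut)) (trans su≡sv (s-cut v-cut))))

    low-level⇒cut : ∀ {x} → dot β x → s x ≤ℕ n₀ → IsCut x
    low-level⇒cut {x} x∈ sx≤n₀ with cut? x
    ... | yes x-cut   = x-cut
    ... | no x-noncut = ⊥-elim (<⇒≱ (n₀<s-noncut x∈ x-noncut) sx≤n₀)

    high-level⇒noncut : ∀ {x} → dot β x → n₀ <ℕ s x → ¬ IsCut x
    high-level⇒noncut x∈ n₀<sx x-cut = <⇒≱ n₀<sx (s-cut≤n₀ x∈ x-cut)

    s-ramseyan : Ramseyan σ (dot β) s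
    s-ramseyan k x y x′ y′ x<y x′<y′ xy@(x∈ , y∈ , sx , sy , _) xx′@(_ , x′∈ , _ , sx′ , _) xy′@(_ , y′∈ , _ , sy′ , _)
               yx′ yy′ x′y′ with cut? x
    ... | yes x-cut = equal-codes⇒ramsey x∈ x-cut y∈ (cut-at y∈ sy) x′∈ (cut-at x′∈ sx′) y′∈ (cut-at y′∈ sy′)
                        x<y x′<y′ (codes xy) (codes xx′) (codes x′y′)
      where
      k≤n₀ : k ≤ℕ n₀
      k≤n₀ = subst (_≤ℕ n₀) sx (s-cut≤n₀ x∈ x-cut)
      cut-at : ∀ {z} → dot β z → s z ≡ k → IsCut z
      cut-at z∈ sz≡k = low-level⇒cut z∈ (subst (_≤ℕ n₀) (sym sz≡k) k≤n₀)
      codes : ∀ {u v} → Neighbours (dot β) s k u v → code u ≡ code v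
      codes (u∈ , v∈ , su≡k , sv≡k , _) = equal-levels⇒equal-codes u∈ (cut-at u∈ su≡k) v∈ (cut-at v∈ sv≡k) (trans su≡k (sym sv≡k))
    ... | no x-noncut = proj₂ (segmentSplit-spec (last∈β c-last) (last-cut c-last)) (k ∸ n₀) x y x′ y′ x<y x′<y′
                          (local xy refl ly) (local xx′ refl lx′) (local xy′ refl ly′)
                          (local yx′ ly lx′) (local yy′ ly ly′) (local x′y′ lx′ ly′)
      where
      c-last = lastCut-spec (proj₁ x∈)
      n₀<k : n₀ <ℕ k
      n₀<k = subst (n₀ <ℕ_) sx (n₀<s-noncut x∈ x-noncut)
      noncut-at : ∀ {z} → dot β z → s z ≡ k → ¬ IsCut z
      noncut-at z∈ sz≡k = high-level⇒noncut z∈ (subst (n₀ <ℕ_) (sym sz≡k) n₀<k)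
      same-as-x : ∀ {z} → Neighbours (dot β) s k x z → lastCut z ≡ lastCut x
      same-as-x nb@(_ , z∈ , _ , sz≡k , _) = sym (neighbours-same-lastCut n₀<k nb x-noncut (noncut-at z∈ sz≡k))
      ly = same-as-x xy
      lx′ = same-as-x xx′
      ly′ = same-as-x xy′
      local : ∀ {u v} → Neighbours (dot β) s k u v → lastCut u ≡ lastCut x → lastCut v ≡ lastCut x →
              Neighbours (dot (Segment (lastCut x))) (segmentSplit (lastCut x)) (k ∸ n₀) u v
      local nb@(u∈ , v∈ , su≡k , sv≡k , _) lu lv =
        neighbours-in-Segment n₀<k (last∈β c-last) (last-cut c-last) nb (noncut-at u∈ su≡k) (noncut-at v∈ sv≡k) lu lv

    ramseyan-split : ∃ (IsRamseyanSplit α S σ (dot β) ∣ E ∣)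
    ramseyan-split = s , s-isSplit , s-ramseyan

module _ (em : ExcludedMiddle) (S : FiniteSemigroup) (α : LinearOrdering)
  (σ : LinearOrdering.Carrier α → LinearOrdering.Carrier α → Fin (FiniteSemigroup.size S))
  (additive : Labelling.IsAdditive α S σ) where
  open FiniteSemigroup S
  open LO α
  open Labelling α S

  ∃-ramseyan-split : ∀ n (E : Subset size) → ∣ E ∣ <ℕ n → Green.DClosed S E →
    ∀ β → WellOrdered β → ImageIn σ β E → ∃ (IsRamseyanSplit α S σ (dot β) ∣ E ∣)
  ∃-ramseyan-split (suc n) E (s≤s ∣E∣≤n) E-closed β β-wo σβ⊆E with em (∃ (dot β))
  ... | no ¬dot = (λ _ → 1) , (λ x x∈ → ⊥-elim (¬dot (x , x∈))) ,
                  λ _ x _ _ _ _ _ xy _ _ _ _ _ → ⊥-elim (¬dot (x , proj₁ xy))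
  ... | yes (x , βx , y , βy , y<x) = C.Split.ramseyan-split IH
    where
    d₀ = MinimalDClass.∃-J-minimal S E em (σβ⊆E y x βy βx y<x)
    b₀ = β-wo β (λ _ βz → βz) (x , βx)
    module C = Construction em S α σ additive E E-closed (proj₁ d₀) (proj₂ d₀) β β-wo σβ⊆E (proj₁ b₀) (proj₂ b₀)
    IH : ∀ β′ → WellOrdered β′ → ImageIn σ β′ C.E′ → ∃ (IsRamseyanSplit α S σ (dot β′) ∣ C.E′ ∣)
    IH = ∃-ramseyan-split n C.E′ (<-≤-trans C.∣E′∣<∣E∣ ∣E∣≤n) C.E′-closed

lemma5 : ExcludedMiddle → (S : FiniteSemigroup) → (α : LinearOrdering) →
    LO.Complete α →
    (σ : LinearOrdering.Carrier α → LinearOrdering.Carrier α → Fin (FiniteSemigroup.size S)) →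
    Labelling.IsAdditive α S σ →
    (E : Subset (FiniteSemigroup.size S)) → Green.DClosed S E →
    (β : LO.Pred α) → LO.WellOrdered α β → Labelling.ImageIn α S σ β E →
    ∃[ s ] (Labelling.IsSplit α S (LO.dot α β) ∣ E ∣ s × Labelling.Ramseyan α S σ (LO.dot α β) s)
lemma5 em S α _ σ additive E = ∃-ramseyan-split em S α σ additive (suc ∣ E ∣) E ≤-refl
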